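{- Let $A$ be a finite abelian group and $G=A\rtimes\langle b\rangle$, where $|b|=2$ and $a^b=a^{ -1}$ for all $a\in A$. Let $N$ be a proper nontrivial subgroup of $A$ and $D\subseteq A$ a divisible difference set in $A$ relative to $N$ with parameters $(m,n,k,\lambda_1,\lambda_2)$, where $m,n>1$, satisfying the intersection condition, and suppose $k\le mn-k$. Define $$X_0=\{1_G\},\ X_1=N\setminus\{1_G\},\ X_2=A\setminus N,\ X_3=Db,\ X_4=(A\setminus D)b.$$ Then $\mathcal{A}=\mathrm{Span}_{\mathbb{Z}}\{\underline{X_i}:i\in\{0,\dots,4\}\}$ is a Higmanian $S$-ring over $G$.
   Context: For a finite group $H$ and $N\le H$, a nonempty $D\subseteq H$ is a divisible difference set (DDS) relative to $N$ with parameters $(m,n,k,\lambda_1,\lambda_2)$, where $m=|H:N|$, $n=|N|$, $k=|D|$, if every nonidentity element of $N$ has exactly $\lambda_1$ representations $d_1d_2^{ -1}$ ($d_1,d_2\in D$) and every element of $H\setminus N$ has exactly $\lambda_2$ such representations. $D$ satisfies the intersection condition if $|D\cap Nh|$ does not depend on $h\in H$. For $X\subseteq G$, $\underline{X}=\sum_{x\in X}x\in\mathbb{Z}G$, $X^{ -1}=\{x^{ -1}:x\in X\}$, $\mathrm{rad}(X)=\{g:gX=Xg=X\}$. A subring $\mathcal{A}\subseteq\mathbb{Z}G$ is an $S$-ring over $G$ if there is a partition $\mathcal{S}$ of $G$ (basic sets) with $\{1_G\}\in\mathcal{S}$, $X^{ -1}\in\mathcal{S}$ for $X\in\mathcal{S}$,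 and $\mathcal{A}=\mathrm{Span}_{\mathbb{Z}}\{\underline{X}:X\in\mathcal{S}\}$. An $\mathcal{A}$-subgroup is a subgroup that is a union of basic sets. $\mathcal{A}$ is Higmanian if $|\mathcal{S}|=5$, $X^{ -1}=X$ for all $X\in\mathcal{S}$, there exist $X_1,X_2\in\mathcal{S}$ such that $\{1_G\}\cup X_1$ and $\{1_G\}\cup X_1\cup X_2$ are $\mathcal{A}$-subgroups, and $\mathrm{rad}(X)=\{1_G\}$ for every $X\in\mathcal{S}$ not contained in $\{1_G\}\cup X_1\cup X_2$. -}

module Defs where

open import Data.Nat using (ℕ; zero; suc; _+_; _*_)
open import Data.Integer as ℤ using (ℤ; +_)
open import Data.Bool using (Bool; true; false; _∧_; _∨_; not; if_then_else_)
import Data.Bool.Properties as BoolP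
open import Data.Fin using (Fin; zero; suc)
open import Data.List using (List; []; _∷_; map; _++_)
open import Data.List.Membership.Propositional using (_∈_)
open import Data.List.Relation.Unary.Unique.Propositional using (Unique)
open import Data.Product using (Σ; ∃; ∃-syntax; _×_; _,_)
import Data.Product.Properties as ProdP
open import Data.Sum using (_⊎_)
open import Relation.Nullary using (¬_)
open import Relation.Nullary.Decidable using (⌊_⌋)
open import Relation.Binary.PropositionalEquality using (_≡_)
open import Relation.Binary.Definitions using (DecidableEquality)
open import Algebra.Structures using (IsAbelianGroup)

record FinGroupData : Set₁ where
  field
    Carrier : Set
    _·_     : Carrier → Carrier → Carrier
    e       : Carrier
    inv     : Carrier → Carrier
    _≟_     : DecidableEquality Carrier
    elems   : List Carrier

record FinAbGroup : Set₁ where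
  field
    grp : FinGroupData
  open FinGroupData grp
  field
    isAbelianGroup : IsAbelianGroup _≡_ _·_ e inv
    elems-complete : ∀ x → x ∈ elems
    elems-unique   : Unique elems

Subset : Set → Set
Subset C = C → Bool

module _ {C : Set} where

  _∈ˢ_ : C → Subset C → Set
  x ∈ˢ X = X x ≡ true

  _⊆ˢ_ : Subset C → Subset C → Set
  X ⊆ˢ Y = ∀ x → x ∈ˢ X → x ∈ˢ Y

  _≐_ : Subset C → Subset C → Set
  X ≐ Y = ∀ x → X x ≡ Y x

  _∪ˢ_ : Subset C → Subset C → Subset C
  (X ∪ˢ Y) x = X x ∨ Y x

  _∩ˢ_ : Subset C → Subset C → Subset C
  (X ∩ˢ Y) x = X x ∧ Y x

  countL : Subset C → List C → ℕ
  countL X []       = 0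
  countL X (x ∷ xs) = (if X x then 1 else 0) + countL X xs

  sumL : (C → ℕ) → List C → ℕ
  sumL f []       = 0
  sumL f (x ∷ xs) = f x + sumL f xs

  sumZL : (C → ℤ) → List C → ℤ
  sumZL f []       = + 0
  sumZL f (x ∷ xs) = f x ℤ.+ sumZL f xs

sumFin : (r : ℕ) → (Fin r → ℤ) → ℤ
sumFin zero    f = + 0
sumFin (suc r) f = f zero ℤ.+ sumFin r (λ i → f (suc i))

module _ (G : FinGroupData) where
  open FinGroupData G

  card : Subset Carrier → ℕ
  card X = countL X elems

  singletonE : Subset Carrier
  singletonE x = ⌊ x ≟ e ⌋

  IsSubgroup : Subset Carrier → Set
  IsSubgroup H = (e ∈ˢ H)
               × (∀ x y → x ∈ˢ H → y ∈ˢ H → (x · y) ∈ˢ H)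
               × (∀ x → x ∈ˢ H → inv x ∈ˢ H)

  invSet : Subset Carrier → Subset Carrier
  invSet X x = X (inv x)

  -- right coset N h = { x · h : x ∈ N }  (x ∈ N h  iff  x · h⁻¹ ∈ N)
  rcoset : Subset Carrier → Carrier → Subset Carrier
  rcoset N h x = N (x · inv h)

  reps : Subset Carrier → Carrier → ℕ
  reps D g = sumL (λ d₁ → countL (λ d₂ → D d₁ ∧ D d₂ ∧ ⌊ (d₁ · inv d₂) ≟ g ⌋) elems) elems

  IsDDS : Subset Carrier → Subset Carrier → ℕ → ℕ → ℕ → ℕ → ℕ → Set
  IsDDS N D m n k λ₁ λ₂ =
      IsSubgroup N
    × card N ≡ n
    × card (λ _ → true) ≡ m * n
    × card D ≡ k
    × (∃[ d ] d ∈ˢ D)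
    × (∀ g → g ∈ˢ N → ¬ g ≡ e → reps D g ≡ λ₁)
    × (∀ g → N g ≡ false → reps D g ≡ λ₂)

  IntersectionCondition : Subset Carrier → Subset Carrier → Set
  IntersectionCondition N D =
    ∀ h h′ → card (D ∩ˢ rcoset N h) ≡ card (D ∩ˢ rcoset N h′)

  -- group ring ℤG: functions G → ℤ;  X ↦ X̲
  ZG : Set
  ZG = Carrier → ℤ

  under : Subset Carrier → ZG
  under X x = if X x then + 1 else + 0

  _⋆_ : ZG → ZG → ZG
  (f ⋆ h) x = sumZL (λ y → f y ℤ.* h (inv y · x)) elems

  -- the family S : Fin r → Subset is the set of basic sets of an S-ring,
  -- namely Span_ℤ { X̲ : X ∈ S } (which is then an S-ring over G)
  IsSRing : (r : ℕ) → (Fin r → Subset Carrier) → Set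
  IsSRing r S =
      (∀ i → ∃[ x ] x ∈ˢ S i)
    × (∀ i j x → x ∈ˢ S i → x ∈ˢ S j → i ≡ j)
    × (∀ x → ∃[ i ] x ∈ˢ S i)
    × (∃[ i ] S i ≐ singletonE)
    × (∀ i → ∃[ j ] S j ≐ invSet (S i))
    × (∀ i j → Σ (Fin r → ℤ) λ c → (∀ x → (under (S i) ⋆ under (S j)) x
                              ≡ sumFin r (λ k → c k ℤ.* under (S k) x)))

  IsASubgroup : (r : ℕ) → (Fin r → Subset Carrier) → Subset Carrier → Set
  IsASubgroup r S H =
    IsSubgroup H × (∀ i → (S i ⊆ˢ H) ⊎ (∀ x → x ∈ˢ S i → ¬ x ∈ˢ H))

  InRad : Subset Carrier → Carrier → Set
  InRad X g =
      (∀ x → x ∈ˢ X → (g · x) ∈ˢ X) × (∀ y → y ∈ˢ X → ∃[ x ] x ∈ˢ X × (g · x) ≡ y)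
    × (∀ x → x ∈ˢ X → (x · g) ∈ˢ X) × (∀ y → y ∈ˢ X → ∃[ x ] x ∈ˢ X × (x · g) ≡ y)

  RadTrivial : Subset Carrier → Set
  RadTrivial X = ∀ g → (InRad X g → g ≡ e) × (g ≡ e → InRad X g)

  -- Higmanian S-ring with the 5 basic sets S 0, …, S 4
  -- (a partition into 5 nonempty disjoint blocks, so |S| = 5)
  IsHigmanian : (Fin 5 → Subset Carrier) → Set
  IsHigmanian S =
      IsSRing 5 S
    × (∀ i → invSet (S i) ≐ S i)
    × (∃[ i₁ ] ∃[ i₂ ]
          IsASubgroup 5 S (singletonE ∪ˢ S i₁)
        × IsASubgroup 5 S ((singletonE ∪ˢ S i₁) ∪ˢ S i₂)
        × (∀ j → ¬ (S j ⊆ˢ ((singletonE ∪ˢ S i₁) ∪ˢ S i₂)) → RadTrivial (S j)))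

-- The element (a , s) encodes a · b^s  (s = false: a, s = true: a b).
-- (a b^s)(a′ b^t) = a (b^s a′ b^{-s}) b^{s+t} = a · a′^{±1} · b^{s xor t}.

module _ (A : FinAbGroup) where
  private
    module A = FinGroupData (FinAbGroup.grp A)

  semidirect : FinGroupData
  semidirect = record
    { Carrier = A.Carrier × Bool
    ; _·_     = λ { (a , s) (a′ , t) →
                    (A._·_ a (if s then A.inv a′ else a′)) , (if s then not t else t) }
    ; e       = A.e , false
    ; inv     = λ { (a , false) → A.inv a , false ; (a , true) → a , true }
    ; _≟_     = ProdP.≡-dec A._≟_ BoolP._≟_
    ; elems   = map (λ a → a , false) A.elems ++ map (λ a → a , true) A.elems
    }

  Xs : Subset A.Carrier → Subset A.Carrier → Fin 5 → Subset (A.Carrier × Bool)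
  Xs N D zero (a , s) = not s ∧ ⌊ a A.≟ A.e ⌋
  Xs N D (suc zero) (a , s) = not s ∧ N a ∧ not ⌊ a A.≟ A.e ⌋
  Xs N D (suc (suc zero)) (a , s) = not s ∧ not (N a)
  Xs N D (suc (suc (suc zero))) (a , s) = s ∧ D a
  Xs N D (suc (suc (suc (suc zero)))) (a , s) = s ∧ not (D a)

-- Write ℤA for the integral group ring of A, u⁻ for a ↦ u(a⁻¹), and f₀ + f₁b (f₀, f₁ ∈ ℤA) for an element
-- of ℤG. The ℤ-span of X₀, …, X₄ consists of the f₀ + f₁b with f₀ ∈ ⟨e, N, A⟩ and f₁ ∈ ⟨D, A⟩, and since
-- b a b = a⁻¹,
--   (f₀ + f₁b)(h₀ + h₁b) = (f₀h₀ + f₁h₁⁻) + (f₀h₁ + f₁h₀⁻)b.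
-- Closure under multiplication thus comes down to products in ℤA: e is the unit, every product with A is a
-- multiple of A, NN = |N|N, ND = |D ∩ N|A by the intersection condition, and DD⁻ = |D|e + λ₁(N − e) + λ₂(A − N)
-- because D is a divisible difference set. An element of the radical of Db or of (A∖D)b lies in A and translates D
-- onto itself, so if it is not e then λ₁ = |D| or λ₂ = |D|. In the first case D is a union of N-cosets, against
-- the intersection condition; in the second D is stable under A∖N, which generates A, so D = A, against
-- k ≤ mn − k.

module Submission where

open import Defs
import Data.Integer.Properties as ℤP
open import Algebra.Bundles using (AbelianGroup)
open import Algebra.Properties.CommutativeSemigroup ℤP.*-commutativeSemigroup using (x∙yz≈y∙xz)
open import Algebra.Properties.Semiring.Sum ℤP.+-*-semiring
  using (sum; sum-cong-≗; sum-replicate-zero; ∑-distrib-+; ∑-comm; *-distribˡ-sum; *-distribʳ-sum)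
open import Data.Bool using (Bool; true; false; _∧_; _∨_; not; if_then_else_)
open import Data.Bool.Properties
  using (∧-idem; ∧-identityʳ; ∧-zeroʳ; ∨-zeroʳ; not-injective; not-¬; ¬-not; ⇔→≡)
import Data.Bool.Properties as Bool
open import Data.Empty using (⊥-elim)
open import Data.Fin using (Fin; zero; suc)
import Data.Fin as Fin
open import Data.Fin.Patterns
open import Data.Fin.Properties using (suc-injective)
open import Data.Integer using (ℤ; +_)
import Data.Integer as Int
open import Data.Integer.Tactic.RingSolver using (solve-∀)
open import Data.List using (List; []; _∷_; _++_; map; lookup)
open import Data.List.Membership.Propositional using (_∈_; lose)
open import Data.List.Relation.Unary.All using (All; []; _∷_)
open import Data.List.Relation.Unary.AllPairs using (_∷_)
open import Data.List.Relation.Unary.Any using (here; there; any?; satisfied)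
open import Data.List.Relation.Unary.Unique.Propositional using (Unique)
open import Data.Nat as ℕ using (ℕ; zero; suc; _<_; _≤_; z≤n; s≤s)
import Data.Nat.Properties as ℕP
open import Data.Product using (Σ; ∃-syntax; _×_; _,_; proj₁; proj₂)
open import Data.Sum using (_⊎_; inj₁; inj₂; [_,_]′)
open import Function using (_∘_; mk⇔)
open import Relation.Binary.Definitions using (DecidableEquality)
open import Relation.Binary.PropositionalEquality
open import Relation.Nullary using (¬_; yes; no)
open import Relation.Nullary.Decidable using (⌊_⌋; ⌊⌋-map′; isYes≗does; does-⇔)

⟦_⟧ : Bool → ℤ
⟦ b ⟧ = if b then + 1 else + 0

⌊≟⌋-cong : ∀ {C : Set} (_≟_ : DecidableEquality C) {x y u v : C} →
  (x ≡ y → u ≡ v) → (u ≡ v → x ≡ y) → ⌊ x ≟ y ⌋ ≡ ⌊ u ≟ v ⌋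
⌊≟⌋-cong _≟_ {x} {y} {u} {v} to from =
  trans (isYes≗does (x ≟ y))
        (trans (does-⇔ (mk⇔ to from) (x ≟ y) (u ≟ v)) (sym (isYes≗does (u ≟ v))))

module _ {C : Set} where

  countL-cong : ∀ {P Q : Subset C} xs → P ≗ Q → countL P xs ≡ countL Q xs
  countL-cong []       P≗Q = refl
  countL-cong (x ∷ xs) P≗Q =
    cong₂ (λ b n → (if b then 1 else 0) ℕ.+ n) (P≗Q x) (countL-cong xs P≗Q)

  countL-∧-≤ : ∀ (P Q : Subset C) xs → countL (λ x → P x ∧ Q x) xs ≤ countL P xs
  countL-∧-≤ P Q []       = z≤n
  countL-∧-≤ P Q (y ∷ ys) with P y | Q y
  ... | true  | true  = s≤s (countL-∧-≤ P Q ys)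
  ... | true  | false = ℕP.m≤n⇒m≤1+n (countL-∧-≤ P Q ys)
  ... | false | _     = countL-∧-≤ P Q ys

  countL-∧-full : ∀ (P Q : Subset C) xs → countL (λ x → P x ∧ Q x) xs ≡ countL P xs →
    ∀ {x} → x ∈ xs → P x ≡ true → Q x ≡ true
  countL-∧-full P Q (y ∷ ys) eq x∈ Px with P y in Py | Q y in Qy | x∈
  ... | true  | true  | here refl  = Qy
  ... | true  | true  | there x∈ys = countL-∧-full P Q ys (ℕP.suc-injective eq) x∈ys Px
  ... | true  | false | _          = ⊥-elim (ℕP.<⇒≱ (ℕP.≤-reflexive (sym eq)) (countL-∧-≤ P Q ys))
  ... | false | _     | here refl  = ⊥-elim (not-¬ Px Py)
  ... | false | _     | there x∈ys = countL-∧-full P Q ys eq x∈ys Px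

  countL-none : ∀ {P : Subset C} xs → (∀ x → P x ≡ false) → countL P xs ≡ 0
  countL-none []       P≡false = refl
  countL-none (x ∷ xs) P≡false rewrite P≡false x = countL-none xs P≡false

  countL-≡0 : ∀ {P : Subset C} xs → countL P xs ≡ 0 → ∀ {x} → x ∈ xs → P x ≡ false
  countL-≡0 {P} (y ∷ ys) eq x∈ with P y in Py | x∈
  ... | false | here refl  = Py
  ... | false | there x∈ys = countL-≡0 ys eq x∈ys

module FiniteSums where
  open Int using (_+_; _*_)

  sumZL≡sum : ∀ {C : Set} (f : C → ℤ) (xs : List C) → sumZL f xs ≡ sum (f ∘ lookup xs)
  sumZL≡sum f []       = refl
  sumZL≡sum f (x ∷ xs) = cong (_+_ (f x)) (sumZL≡sum f xs)

  sumFin≡sum : ∀ r (f : Fin r → ℤ) → sumFin r f ≡ sum f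
  sumFin≡sum zero    f = refl
  sumFin≡sum (suc r) f = cong (_+_ (f zero)) (sumFin≡sum r (f ∘ suc))

  sum-sift : ∀ {r} (t : Fin r) (f : Fin r → ℤ) → sum (λ s → ⟦ ⌊ s Fin.≟ t ⌋ ⟧ * f s) ≡ f t
  sum-sift {suc r} zero f = begin
    + 1 * f zero + sum {r} (λ _ → + 0)
      ≡⟨ cong₂ _+_ (ℤP.*-identityˡ (f zero)) (sum-replicate-zero r) ⟩
    f zero + + 0
      ≡⟨ ℤP.+-identityʳ (f zero) ⟩
    f zero
      ∎
    where open ≡-Reasoning
  sum-sift {suc r} (suc t) f = begin
    + 0 * f zero + sum (λ s → ⟦ ⌊ suc s Fin.≟ suc t ⌋ ⟧ * f (suc s))
      ≡⟨ ℤP.+-identityˡ _ ⟩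
    sum (λ s → ⟦ ⌊ suc s Fin.≟ suc t ⌋ ⟧ * f (suc s))
      ≡⟨ sum-cong-≗ (λ s → cong (λ b → ⟦ b ⟧ * f (suc s)) (⌊⌋-map′ (cong suc) suc-injective (s Fin.≟ t))) ⟩
    sum (λ s → ⟦ ⌊ s Fin.≟ t ⌋ ⟧ * f (suc s))
      ≡⟨ sum-sift t (f ∘ suc) ⟩
    f (suc t)
      ∎
    where open ≡-Reasoning

  ⟦∧⟧ : ∀ b c → ⟦ b ∧ c ⟧ ≡ ⟦ b ⟧ * ⟦ c ⟧
  ⟦∧⟧ true  c = sym (ℤP.*-identityˡ ⟦ c ⟧)
  ⟦∧⟧ false c = refl

  module _ {C : Set} where

    sumZL-cong : ∀ {f g : C → ℤ} xs → f ≗ g → sumZL f xs ≡ sumZL g xs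
    sumZL-cong []       f≗g = refl
    sumZL-cong (x ∷ xs) f≗g = cong₂ _+_ (f≗g x) (sumZL-cong xs f≗g)

    sumZL-*ˡ : ∀ z (f : C → ℤ) xs → sumZL (λ x → z * f x) xs ≡ z * sumZL f xs
    sumZL-*ˡ z f xs = begin
      sumZL (λ x → z * f x) xs          ≡⟨ sumZL≡sum _ xs ⟩
      sum (λ i → z * f (lookup xs i))   ≡⟨ sym (*-distribˡ-sum z (f ∘ lookup xs)) ⟩
      z * sum (f ∘ lookup xs)           ≡⟨ cong (z *_) (sym (sumZL≡sum f xs)) ⟩
      z * sumZL f xs                    ∎
      where open ≡-Reasoning

    sumZL-sum-comm : ∀ {r} (g : C → Fin r → ℤ) xs →
      sumZL (λ x → sum (g x)) xs ≡ sum (λ t → sumZL (λ x → g x t) xs)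
    sumZL-sum-comm g xs = begin
      sumZL (λ x → sum (g x)) xs
        ≡⟨ sumZL≡sum _ xs ⟩
      sum (λ i → sum (g (lookup xs i)))
        ≡⟨ ∑-comm (g ∘ lookup xs) ⟩
      sum (λ t → sum (λ i → g (lookup xs i) t))
        ≡⟨ sum-cong-≗ (λ t → sym (sumZL≡sum (λ x → g x t) xs)) ⟩
      sum (λ t → sumZL (λ x → g x t) xs)
        ∎
      where open ≡-Reasoning

    sumZL-comm : ∀ {B : Set} (g : C → B → ℤ) xs ys →
      sumZL (λ x → sumZL (g x) ys) xs ≡ sumZL (λ y → sumZL (λ x → g x y) xs) ys
    sumZL-comm g xs ys = begin
      sumZL (λ x → sumZL (g x) ys) xs
        ≡⟨ sumZL-cong xs (λ x → sumZL≡sum (g x) ys) ⟩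
      sumZL (λ x → sum (g x ∘ lookup ys)) xs
        ≡⟨ sumZL-sum-comm (λ x → g x ∘ lookup ys) xs ⟩
      sum (λ j → sumZL (λ x → g x (lookup ys j)) xs)
        ≡⟨ sym (sumZL≡sum (λ y → sumZL (λ x → g x y) xs) ys) ⟩
      sumZL (λ y → sumZL (λ x → g x y) xs) ys
        ∎
      where open ≡-Reasoning

    sumZL-++ : ∀ (f : C → ℤ) xs ys → sumZL f (xs ++ ys) ≡ sumZL f xs + sumZL f ys
    sumZL-++ f []       ys = sym (ℤP.+-identityˡ _)
    sumZL-++ f (x ∷ xs) ys = trans (cong (_+_ (f x)) (sumZL-++ f xs ys)) (sym (ℤP.+-assoc (f x) _ _))

    sumZL-map : ∀ {B : Set} (f : C → ℤ) (g : B → C) xs → sumZL f (map g xs) ≡ sumZL (f ∘ g) xs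
    sumZL-map f g []       = refl
    sumZL-map f g (x ∷ xs) = cong (_+_ (f (g x))) (sumZL-map f g xs)

    countL≡sumZL : ∀ (P : Subset C) xs → + countL P xs ≡ sumZL (⟦_⟧ ∘ P) xs
    countL≡sumZL P []       = refl
    countL≡sumZL P (x ∷ xs) = trans (ℤP.pos-+ (if P x then 1 else 0) (countL P xs))
                                    (cong₂ _+_ (⟦⟧-pos (P x)) (countL≡sumZL P xs))
      where
      ⟦⟧-pos : ∀ b → + (if b then 1 else 0) ≡ ⟦ b ⟧
      ⟦⟧-pos true  = refl
      ⟦⟧-pos false = refl

    sumL≡sumZL : ∀ (f : C → ℕ) xs → + sumL f xs ≡ sumZL (+_ ∘ f) xs
    sumL≡sumZL f []       = refl
    sumL≡sumZL f (x ∷ xs) = trans (ℤP.pos-+ (f x) (sumL f xs)) (cong (_+_ (+ f x)) (sumL≡sumZL f xs))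

    module _ (_≟_ : DecidableEquality C) (g : C → ℤ) where

      sumZL-sift-∉ : ∀ z xs → All (z ≢_) xs → sumZL (λ x → ⟦ ⌊ x ≟ z ⌋ ⟧ * g x) xs ≡ + 0
      sumZL-sift-∉ z []       []           = refl
      sumZL-sift-∉ z (x ∷ xs) (z≢x ∷ z∉xs) with x ≟ z
      ... | yes x≡z = ⊥-elim (z≢x (sym x≡z))
      ... | no  _   = trans (ℤP.+-identityˡ _) (sumZL-sift-∉ z xs z∉xs)

      sumZL-sift : ∀ z xs → Unique xs → z ∈ xs → sumZL (λ x → ⟦ ⌊ x ≟ z ⌋ ⟧ * g x) xs ≡ g z
      sumZL-sift z (x ∷ xs) (x∉xs ∷ unique) z∈ with x ≟ z | z∈
      ... | yes refl | _          = begin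
        + 1 * g x + sumZL (λ y → ⟦ ⌊ y ≟ x ⌋ ⟧ * g y) xs
          ≡⟨ cong₂ _+_ (ℤP.*-identityˡ (g x)) (sumZL-sift-∉ x xs x∉xs) ⟩
        g x + + 0
          ≡⟨ ℤP.+-identityʳ (g x) ⟩
        g x
          ∎
        where open ≡-Reasoning
      ... | no x≢z   | here z≡x   = ⊥-elim (x≢z (sym z≡x))
      ... | no _     | there z∈xs = trans (ℤP.+-identityˡ _) (sumZL-sift z xs unique z∈xs)

open FiniteSums

module GroupRing (G : FinGroupData) where
  open FinGroupData G using (Carrier; _·_; inv; elems)
  open Int using (_+_; _*_)

  infixl 7 _∗_
  _∗_ : ZG G → ZG G → ZG G
  _∗_ = _⋆_ G

  lin : ∀ {r} → (Fin r → ℤ) → (Fin r → ZG G) → ZG G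
  lin c W x = sum (λ t → c t * W t x)

  infix 4 _∈Span_
  record _∈Span_ {r} (f : ZG G) (W : Fin r → ZG G) : Set where
    constructor _,_
    field
      coefficients : Fin r → ℤ
      expansion    : f ≗ lin coefficients W

  module _ {r} {W : Fin r → ZG G} where

    ∈Span-resp : ∀ {f g} → f ≗ g → g ∈Span W → f ∈Span W
    ∈Span-resp f≗g (c , g≗) = c , λ x → trans (f≗g x) (g≗ x)

    basis : ∀ t → W t ∈Span W
    basis t = (λ s → ⟦ ⌊ s Fin.≟ t ⌋ ⟧) , λ x → sym (sum-sift t (λ s → W s x))

    ∈Span-+ : ∀ {f g} → f ∈Span W → g ∈Span W → (λ x → f x + g x) ∈Span W
    ∈Span-+ {f} {g} (c , f≗) (d , g≗) = (λ t → c t + d t) , λ x → begin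
      f x + g x
        ≡⟨ cong₂ _+_ (f≗ x) (g≗ x) ⟩
      lin c W x + lin d W x
        ≡⟨ sym (∑-distrib-+ (λ t → c t * W t x) (λ t → d t * W t x)) ⟩
      sum (λ t → c t * W t x + d t * W t x)
        ≡⟨ sum-cong-≗ (λ t → sym (ℤP.*-distribʳ-+ (W t x) (c t) (d t))) ⟩
      lin (λ t → c t + d t) W x
        ∎
      where open ≡-Reasoning

    ∈Span-* : ∀ z {f} → f ∈Span W → (λ x → z * f x) ∈Span W
    ∈Span-* z {f} (c , f≗) = (λ t → z * c t) , λ x → begin
      z * f x                        ≡⟨ cong (z *_) (f≗ x) ⟩
      z * lin c W x                  ≡⟨ *-distribˡ-sum z (λ t → c t * W t x) ⟩
      sum (λ t → z * (c t * W t x))  ≡⟨ sum-cong-≗ (λ t → sym (ℤP.*-assoc z (c t) (W t x))) ⟩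
      lin (λ t → z * c t) W x        ∎
      where open ≡-Reasoning

    ∈Span-lin : ∀ {q} (a : Fin q → ℤ) {F : Fin q → ZG G} → (∀ i → F i ∈Span W) → lin a F ∈Span W
    ∈Span-lin a {F} F∈ = (λ t → sum (λ i → a i * c i t)) , λ x → begin
      sum (λ i → a i * F i x)
        ≡⟨ sum-cong-≗ (λ i → cong (a i *_) (_∈Span_.expansion (F∈ i) x)) ⟩
      sum (λ i → a i * lin (c i) W x)
        ≡⟨ sum-cong-≗ (λ i → *-distribˡ-sum (a i) (λ t → c i t * W t x)) ⟩
      sum (λ i → sum (λ t → a i * (c i t * W t x)))
        ≡⟨ ∑-comm (λ i t → a i * (c i t * W t x)) ⟩
      sum (λ t → sum (λ i → a i * (c i t * W t x)))
        ≡⟨ sum-cong-≗ (λ t → sum-cong-≗ (λ i → sym (ℤP.*-assoc (a i) (c i t) (W t x)))) ⟩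
      sum (λ t → sum (λ i → a i * c i t * W t x))
        ≡⟨ sum-cong-≗ (λ t → sym (*-distribʳ-sum (W t x) (λ i → a i * c i t))) ⟩
      lin (λ t → sum (λ i → a i * c i t)) W x
        ∎
      where
      open ≡-Reasoning
      c : ∀ i → Fin r → ℤ
      c i = _∈Span_.coefficients (F∈ i)

    ∈Span-const : ∀ t → (∀ x → W t x ≡ + 1) → ∀ z → (λ _ → z) ∈Span W
    ∈Span-const t Wt≡1 z =
      ∈Span-resp (λ x → sym (trans (cong (z *_) (Wt≡1 x)) (ℤP.*-identityʳ z))) (∈Span-* z (basis t))

  ∈Span-∘ : ∀ {r} {W : Fin r → ZG G} (g : Carrier → Carrier) {f} →
    f ∈Span W → (f ∘ g) ∈Span (λ t → W t ∘ g)
  ∈Span-∘ g (c , f≗) = c , (f≗ ∘ g)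

  ⋆-cong : ∀ {f f′ h h′} → f ≗ f′ → h ≗ h′ → f ∗ h ≗ f′ ∗ h′
  ⋆-cong f≗ h≗ x = sumZL-cong elems (λ y → cong₂ _*_ (f≗ y) (h≗ (inv y · x)))

  ⋆-linˡ : ∀ {r} (a : Fin r → ℤ) U h → lin a U ∗ h ≗ lin a (λ i → U i ∗ h)
  ⋆-linˡ a U h x = begin
    sumZL (λ y → lin a U y * h (inv y · x)) elems
      ≡⟨ sumZL-cong elems (λ y → *-distribʳ-sum (h (inv y · x)) (λ i → a i * U i y)) ⟩
    sumZL (λ y → sum (λ i → a i * U i y * h (inv y · x))) elems
      ≡⟨ sumZL-cong elems (λ y → sum-cong-≗ (λ i → ℤP.*-assoc (a i) (U i y) _)) ⟩
    sumZL (λ y → sum (λ i → a i * (U i y * h (inv y · x)))) elems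
      ≡⟨ sumZL-sum-comm (λ y i → a i * (U i y * h (inv y · x))) elems ⟩
    sum (λ i → sumZL (λ y → a i * (U i y * h (inv y · x))) elems)
      ≡⟨ sum-cong-≗ (λ i → sumZL-*ˡ (a i) _ elems) ⟩
    lin a (λ i → U i ∗ h) x
      ∎
    where open ≡-Reasoning

  ⋆-linʳ : ∀ {r} (b : Fin r → ℤ) f V → f ∗ lin b V ≗ lin b (λ j → f ∗ V j)
  ⋆-linʳ b f V x = begin
    sumZL (λ y → f y * lin b V (inv y · x)) elems
      ≡⟨ sumZL-cong elems (λ y → *-distribˡ-sum (f y) (λ j → b j * V j (inv y · x))) ⟩
    sumZL (λ y → sum (λ j → f y * (b j * V j (inv y · x)))) elems
      ≡⟨ sumZL-cong elems (λ y → sum-cong-≗ (λ j → x∙yz≈y∙xz (f y) (b j) _)) ⟩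
    sumZL (λ y → sum (λ j → b j * (f y * V j (inv y · x)))) elems
      ≡⟨ sumZL-sum-comm (λ y j → b j * (f y * V j (inv y · x))) elems ⟩
    sum (λ j → sumZL (λ y → b j * (f y * V j (inv y · x))) elems)
      ≡⟨ sum-cong-≗ (λ j → sumZL-*ˡ (b j) _ elems) ⟩
    lin b (λ j → f ∗ V j) x
      ∎
    where open ≡-Reasoning

  ∈Span-⋆ : ∀ {p q r} {U : Fin p → ZG G} {V : Fin q → ZG G} {W : Fin r → ZG G} →
    (∀ i j → U i ∗ V j ∈Span W) → ∀ {f h} → f ∈Span U → h ∈Span V → f ∗ h ∈Span W
  ∈Span-⋆ {U = U} {V} UV∈ (a , f≗) (b , h≗) =
    ∈Span-resp (λ x → trans (⋆-cong f≗ h≗ x) (⋆-linˡ a U (lin b V) x))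
      (∈Span-lin a (λ i → ∈Span-resp (⋆-linʳ b (U i) V) (∈Span-lin b (UV∈ i))))

module AbelianGroupRing (A : FinAbGroup) where
  open FinAbGroup A using (grp; isAbelianGroup; elems-complete; elems-unique)
  open FinGroupData grp
  open GroupRing grp public
  open Int using (_*_)

  abelianGroup : AbelianGroup _ _
  abelianGroup = record { isAbelianGroup = isAbelianGroup }

  open AbelianGroup abelianGroup public using (comm; assoc; identityˡ; identityʳ; inverseʳ)
  open import Algebra.Properties.AbelianGroup abelianGroup public
    using ( ε⁻¹≈ε; ⁻¹-involutive; ⁻¹-injective; ⁻¹-anti-homo‿-; quasigroup
          ; \\-leftDividesˡ; \\-leftDividesʳ; //-rightDividesˡ; //-rightDividesʳ)
  open import Algebra.Properties.Quasigroup quasigroup public using (cancelˡ)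

  ∑ : (Carrier → ℤ) → ℤ
  ∑ f = sumZL f elems

  δ : Carrier → Carrier → ℤ
  δ z x = ⟦ ⌊ x ≟ z ⌋ ⟧

  one : ZG grp
  one _ = + 1

  ∑-cong : ∀ {f g} → f ≗ g → ∑ f ≡ ∑ g
  ∑-cong = sumZL-cong elems

  ∑-sift : ∀ z g → ∑ (λ x → δ z x * g x) ≡ g z
  ∑-sift z g = sumZL-sift _≟_ g z elems elems-unique (elems-complete z)

  ∑-reindex : ∀ (σ τ : Carrier → Carrier) → (∀ x → τ (σ x) ≡ x) → (∀ y → σ (τ y) ≡ y) →
    ∀ f → ∑ (f ∘ σ) ≡ ∑ f
  ∑-reindex σ τ τσ στ f = begin
    ∑ (f ∘ σ)                              ≡⟨ ∑-cong (λ x → sym (∑-sift (σ x) f)) ⟩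
    ∑ (λ x → ∑ (λ y → δ (σ x) y * f y))    ≡⟨ sumZL-comm (λ x y → δ (σ x) y * f y) elems elems ⟩
    ∑ (λ y → ∑ (λ x → δ (σ x) y * f y))    ≡⟨ ∑-cong (λ y → ∑-cong (λ x → cong (λ b → ⟦ b ⟧ * f y) (swap x y))) ⟩
    ∑ (λ y → ∑ (λ x → δ (τ y) x * f y))    ≡⟨ ∑-cong (λ y → ∑-sift (τ y) (λ _ → f y)) ⟩
    ∑ f                                    ∎
    where
    open ≡-Reasoning
    swap : ∀ x y → ⌊ y ≟ σ x ⌋ ≡ ⌊ x ≟ τ y ⌋
    swap x y = ⌊≟⌋-cong _≟_ (λ { refl → sym (τσ x) }) (λ { refl → sym (στ y) })

  inv-\\ : ∀ c a → inv (inv c · a) ≡ c · inv a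
  inv-\\ c a = trans (cong inv (comm (inv c) a)) (⁻¹-anti-homo‿- a c)

  \\-involutive : ∀ a c → inv (inv c · a) · a ≡ c
  \\-involutive a c = trans (cong (_· a) (inv-\\ c a)) (//-rightDividesˡ a c)

  x∙[x∙y⁻¹]⁻¹≈y : ∀ x y → x · inv (x · inv y) ≡ y
  x∙[x∙y⁻¹]⁻¹≈y x y = trans (cong (x ·_) (⁻¹-anti-homo‿- x y)) (trans (comm x (y · inv x)) (//-rightDividesˡ x y))

  inv≡e⇒≡e : ∀ a → inv a ≡ e → a ≡ e
  inv≡e⇒≡e a inv-a≡e = ⁻¹-injective (trans inv-a≡e (sym ε⁻¹≈ε))

  ⌊inv≟e⌋ : ∀ a → ⌊ inv a ≟ e ⌋ ≡ ⌊ a ≟ e ⌋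
  ⌊inv≟e⌋ a = ⌊≟⌋-cong _≟_ (inv≡e⇒≡e a) (λ { refl → ε⁻¹≈ε })

  ∑-translate : ∀ a f → ∑ (λ c → f (inv c · a)) ≡ ∑ f
  ∑-translate a = ∑-reindex (λ c → inv c · a) (λ c → inv c · a) (\\-involutive a) (\\-involutive a)

  ⋆-identityˡ : ∀ v → δ e ∗ v ≗ v
  ⋆-identityˡ v a = trans (∑-sift e (λ y → v (inv y · a)))
                          (cong v (trans (cong (_· a) ε⁻¹≈ε) (identityˡ a)))

  ⋆-comm : ∀ u v → u ∗ v ≗ v ∗ u
  ⋆-comm u v a = begin
    ∑ (λ y → u y * v (inv y · a))
      ≡⟨ ∑-cong (λ y → cong (λ z → u z * v (inv y · a)) (sym (\\-involutive a y))) ⟩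
    ∑ (λ y → u (inv (inv y · a) · a) * v (inv y · a))
      ≡⟨ ∑-translate a (λ z → u (inv z · a) * v z) ⟩
    ∑ (λ z → u (inv z · a) * v z)
      ≡⟨ ∑-cong (λ z → ℤP.*-comm (u (inv z · a)) (v z)) ⟩
    ∑ (λ z → v z * u (inv z · a))
      ∎
    where open ≡-Reasoning

  ⋆-identityʳ : ∀ u → u ∗ δ e ≗ u
  ⋆-identityʳ u a = trans (⋆-comm u (δ e) a) (⋆-identityˡ u a)

  ⋆-oneʳ : ∀ u → u ∗ one ≗ λ _ → ∑ u
  ⋆-oneʳ u a = ∑-cong (λ y → ℤP.*-identityʳ (u y))

  ⋆-oneˡ : ∀ v → one ∗ v ≗ λ _ → ∑ v
  ⋆-oneˡ v a = trans (⋆-comm one v a) (⋆-oneʳ v a)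

  ⋆-indicator : ∀ (P Q : Subset Carrier) a →
    (under grp P ∗ under grp Q) a ≡ + countL (λ y → P y ∧ Q (inv y · a)) elems
  ⋆-indicator P Q a = sym (trans (countL≡sumZL _ elems) (∑-cong (λ y → ⟦∧⟧ (P y) (Q (inv y · a)))))

  reps≡countL : ∀ D a → reps grp D a ≡ countL (λ y → D y ∧ D (y · inv a)) elems
  reps≡countL D a = ℤP.+-injective (begin
    + reps grp D a
      ≡⟨ sumL≡sumZL _ elems ⟩
    ∑ (λ x → + countL (λ y → D x ∧ D y ∧ ⌊ (x · inv y) ≟ a ⌋) elems)
      ≡⟨ ∑-cong (λ x → countL≡sumZL _ elems) ⟩
    ∑ (λ x → ∑ (λ y → ⟦ D x ∧ D y ∧ ⌊ (x · inv y) ≟ a ⌋ ⟧))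
      ≡⟨ ∑-cong (λ x → ∑-cong (pointwise x)) ⟩
    ∑ (λ x → ∑ (λ y → δ (x · inv a) y * ⟦ D x ∧ D y ⟧))
      ≡⟨ ∑-cong (λ x → ∑-sift (x · inv a) (λ y → ⟦ D x ∧ D y ⟧)) ⟩
    ∑ (λ x → ⟦ D x ∧ D (x · inv a) ⟧)
      ≡⟨ sym (countL≡sumZL _ elems) ⟩
    + countL (λ y → D y ∧ D (y · inv a)) elems
      ∎)
    where
    open ≡-Reasoning
    rearrange : ∀ x y → ⌊ (x · inv y) ≟ a ⌋ ≡ ⌊ y ≟ (x · inv a) ⌋
    rearrange x y = ⌊≟⌋-cong _≟_ (λ { refl → sym (x∙[x∙y⁻¹]⁻¹≈y x y) }) (λ { refl → x∙[x∙y⁻¹]⁻¹≈y x a })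
    pointwise : ∀ x y → ⟦ D x ∧ D y ∧ ⌊ (x · inv y) ≟ a ⌋ ⟧ ≡ δ (x · inv a) y * ⟦ D x ∧ D y ⟧
    pointwise x y rewrite rearrange x y with D x | D y | ⌊ y ≟ (x · inv a) ⌋
    ... | true  | true  | b = sym (ℤP.*-identityʳ ⟦ b ⟧)
    ... | true  | false | b = sym (ℤP.*-zeroʳ ⟦ b ⟧)
    ... | false | _     | b = sym (ℤP.*-zeroʳ ⟦ b ⟧)

  ⋆-reps : ∀ D → under grp D ∗ (under grp D ∘ inv) ≗ λ a → + reps grp D a
  ⋆-reps D a = trans (⋆-indicator D (D ∘ inv) a) (cong +_ (trans
    (countL-cong elems (λ y → cong (λ x → D y ∧ D x) (inv-\\ y a))) (sym (reps≡countL D a))))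

  module Subgroup {N : Subset Carrier} (N≤ : IsSubgroup grp N) where
    private
      ·-closed = proj₁ (proj₂ N≤)
      inv-closed = proj₂ (proj₂ N≤)

    N-inv : ∀ x → N (inv x) ≡ N x
    N-inv x = ⇔→≡ (mk⇔ (λ p → subst (_∈ˢ N) (⁻¹-involutive x) (inv-closed (inv x) p)) (inv-closed x))

    N-\\ : ∀ {c} → N c ≡ true → ∀ a → N (inv c · a) ≡ N a
    N-\\ {c} c∈N a = ⇔→≡ (mk⇔ (λ p → subst (_∈ˢ N) (\\-leftDividesˡ c a) (·-closed c _ c∈N p))
                              (·-closed (inv c) a (trans (N-inv c) c∈N)))

    ⋆-subgroup : under grp N ∗ under grp N ≗ λ a → ∑ (under grp N) * under grp N a
    ⋆-subgroup a = begin
      ∑ (λ y → ⟦ N y ⟧ * ⟦ N (inv y · a) ⟧)  ≡⟨ ∑-cong pointwise ⟩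
      ∑ (λ y → ⟦ N a ⟧ * ⟦ N y ⟧)            ≡⟨ sumZL-*ˡ ⟦ N a ⟧ (under grp N) elems ⟩
      ⟦ N a ⟧ * ∑ (under grp N)              ≡⟨ ℤP.*-comm ⟦ N a ⟧ _ ⟩
      ∑ (under grp N) * ⟦ N a ⟧              ∎
      where
      open ≡-Reasoning
      pointwise : ∀ y → ⟦ N y ⟧ * ⟦ N (inv y · a) ⟧ ≡ ⟦ N a ⟧ * ⟦ N y ⟧
      pointwise y with N y in y∈N
      ... | true  = trans (cong (λ b → + 1 * ⟦ b ⟧) (N-\\ y∈N a)) (ℤP.*-comm (+ 1) ⟦ N a ⟧)
      ... | false = sym (ℤP.*-zeroʳ ⟦ N a ⟧)

    ⋆-rcoset : ∀ D → under grp D ∗ under grp N ≗ λ a → + card grp (D ∩ˢ rcoset grp N a)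
    ⋆-rcoset D a = trans (⋆-indicator D N a) (cong +_ (countL-cong elems λ y →
      cong (D y ∧_) (trans (sym (N-inv (inv y · a))) (cong N (inv-\\ y a)))))

  RightStable : Subset Carrier → Carrier → Set
  RightStable D h = ∀ x → x ∈ˢ D → (x · h) ∈ˢ D

  stable-· : ∀ {D h h′} → RightStable D h → RightStable D h′ → RightStable D (h · h′)
  stable-· {D} {h} {h′} h-stable h′-stable x x∈D =
    subst (_∈ˢ D) (assoc x h h′) (h′-stable (x · h) (h-stable x x∈D))

  reps≡card⇒stable : ∀ D g → reps grp D g ≡ card grp D → RightStable D (inv g)
  reps≡card⇒stable D g reps≡card x =
    countL-∧-full D (λ y → D (y · inv g)) elems (trans (sym (reps≡countL D g)) reps≡card) (elems-complete x)

  invariant⇒reps≡card : ∀ D c → (∀ a → D (c · a) ≡ D a) → reps grp D c ≡ card grp D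
  invariant⇒reps≡card D c invariant = trans (reps≡countL D c) (countL-cong elems λ y →
    trans (cong (D y ∧_) (trans (sym (invariant (y · inv c))) (cong D (c·[y·c⁻¹]≡y y)))) (∧-idem (D y)))
    where
    c·[y·c⁻¹]≡y : ∀ y → c · (y · inv c) ≡ y
    c·[y·c⁻¹]≡y y = trans (comm c (y · inv c)) (//-rightDividesˡ c y)

  card≢|A|⇒∃∉ : ∀ D → ¬ card grp D ≡ card grp (λ _ → true) → ∃[ d ] D d ≡ false
  card≢|A|⇒∃∉ D card≢ with any? (λ x → D x Bool.≟ false) elems
  ... | yes ∃∉D = satisfied ∃∉D
  ... | no ∄∉D  = ⊥-elim (card≢ (countL-cong elems λ x → ¬-not λ x∉D → ∄∉D (lose (elems-complete x) x∉D)))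

module Semidirect (A : FinAbGroup) where
  open FinAbGroup A using (grp)
  open FinGroupData grp
  open AbelianGroupRing A
  open Int using (_+_; _*_)

  G : FinGroupData
  G = semidirect A

  module ℤG = GroupRing G

  layer : Bool → ZG G → ZG grp
  layer s f a = f (a , s)

  ⋆-layer : ∀ f h s → layer s (f ℤG.∗ h) ≗
    λ a → (layer false f ∗ layer s h) a + (layer true f ∗ (layer (not s) h ∘ inv)) a
  ⋆-layer f h s a = begin
    (f ℤG.∗ h) (a , s)
      ≡⟨ sumZL-++ _ (map (_, false) elems) (map (_, true) elems) ⟩
    _ ≡⟨ cong₂ _+_ (sumZL-map _ (_, false) elems) (trans (sumZL-map _ (_, true) elems)
                   (sumZL-cong elems (λ c → cong (λ x → f (c , true) * h (x , not s)) (sym (inv-\\ c a))))) ⟩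
    (layer false f ∗ layer s h) a + (layer true f ∗ (layer (not s) h ∘ inv)) a
      ∎
    where open ≡-Reasoning

  embed : Bool → ZG grp → ZG G
  embed false u (a , false) = u a
  embed true  u (a , true)  = u a
  embed false u (a , true)  = + 0
  embed true  u (a , false) = + 0

  embed-layers : ∀ f → f ≗ λ x → embed false (layer false f) x + embed true (layer true f) x
  embed-layers f (a , false) = sym (ℤP.+-identityʳ (f (a , false)))
  embed-layers f (a , true)  = sym (ℤP.+-identityˡ (f (a , true)))

  embed-∈Span : ∀ s {r q} {W : Fin r → ZG grp} {V : Fin q → ZG G} →
    (∀ t → embed s (W t) ℤG.∈Span V) → ∀ {u} → u ∈Span W → embed s u ℤG.∈Span V
  embed-∈Span s {r} {W = W} embedW∈ {u} (c , u≗) = ℤG.∈Span-resp (embed-lin s) (ℤG.∈Span-lin c embedW∈)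
    where
    lin-zero : + 0 ≡ sum (λ t → c t * + 0)
    lin-zero = sym (trans (sum-cong-≗ (λ t → ℤP.*-zeroʳ (c t))) (sum-replicate-zero r))
    embed-lin : ∀ s → embed s u ≗ ℤG.lin c (λ t → embed s (W t))
    embed-lin false (a , false) = u≗ a
    embed-lin true  (a , true)  = u≗ a
    embed-lin false (a , true)  = lin-zero
    embed-lin true  (a , false) = lin-zero

module BasicSets (A : FinAbGroup) (N D : Subset (FinGroupData.Carrier (FinAbGroup.grp A)))
  (N≤ : IsSubgroup (FinAbGroup.grp A) N) where

  open FinAbGroup A using (grp)
  open FinGroupData grp
  open AbelianGroupRing A using (ε⁻¹≈ε; identityˡ; identityʳ; cancelˡ; ⌊inv≟e⌋)
  open AbelianGroupRing.Subgroup A N≤ using (N-inv)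

  open Semidirect A public using (G)
  module G = FinGroupData G

  X : Fin 5 → Subset G.Carrier
  X = Xs A N D

  N-e : N e ≡ true
  N-e = proj₁ N≤

  class : G.Carrier → Fin 5
  class (a , false) = if ⌊ a ≟ e ⌋ then 0F else if N a then 1F else 2F
  class (a , true)  = if D a then 3F else 4F

  ∈X-class : ∀ x → x ∈ˢ X (class x)
  ∈X-class (a , false) with a ≟ e in a≟e | N a in a∈N
  ... | yes _ | _     = cong ⌊_⌋ a≟e
  ... | no _  | true  = cong₂ (λ b d → b ∧ not ⌊ d ⌋) a∈N a≟e
  ... | no _  | false = cong not a∈N
  ∈X-class (a , true) with D a in a∈D
  ... | true  = a∈D
  ... | false = cong not a∈D

  class-unique : ∀ i x → x ∈ˢ X i → class x ≡ i
  class-unique 0F (a , false) p with a ≟ e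
  class-unique 0F (a , false) p  | yes _ = refl
  class-unique 0F (a , false) () | no _
  class-unique 1F (a , false) p with a ≟ e | N a
  class-unique 1F (a , false) p  | no _  | true  = refl
  class-unique 1F (a , false) () | yes _ | true
  class-unique 1F (a , false) () | yes _ | false
  class-unique 1F (a , false) () | no _  | false
  class-unique 2F (a , false) p with a ≟ e | N a in a∈N
  class-unique 2F (a , false) p  | no _     | false = refl
  class-unique 2F (a , false) () | _        | true
  class-unique 2F (a , false) p  | yes refl | false with () ← trans (sym N-e) a∈N
  class-unique 3F (a , true) p with D a
  class-unique 3F (a , true) p  | true  = refl
  class-unique 3F (a , true) () | false
  class-unique 4F (a , true) p with D a
  class-unique 4F (a , true) () | true
  class-unique 4F (a , true) p  | false = refl

  X-disjoint : ∀ i j x → x ∈ˢ X i → x ∈ˢ X j → i ≡ j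
  X-disjoint i j x x∈Xi x∈Xj = trans (sym (class-unique i x x∈Xi)) (class-unique j x x∈Xj)

  X-cover : ∀ x → ∃[ i ] x ∈ˢ X i
  X-cover x = class x , ∈X-class x

  X-nonempty : (∃[ x ] N x ≡ true × ¬ x ≡ e) → (∃[ x ] N x ≡ false) →
    (∃[ d ] D d ≡ true) → (∃[ d ] D d ≡ false) → ∀ i → ∃[ x ] x ∈ˢ X i
  X-nonempty _               _         _         _         0F = (e , false) , e∈X₀
    where
    e∈X₀ : ⌊ e ≟ e ⌋ ≡ true
    e∈X₀ with e ≟ e
    ... | yes _  = refl
    ... | no e≢e = ⊥-elim (e≢e refl)
  X-nonempty (h , h∈N , h≢e) _         _         _         1F = (h , false) , h∈X₁
    where
    h∈X₁ : N h ∧ not ⌊ h ≟ e ⌋ ≡ true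
    h∈X₁ with h ≟ e
    ... | yes h≡e = ⊥-elim (h≢e h≡e)
    ... | no _    = trans (∧-identityʳ (N h)) h∈N
  X-nonempty _               (w , w∉N) _         _         2F = (w , false) , cong not w∉N
  X-nonempty _               _         (d , d∈D) _         3F = (d , true) , d∈D
  X-nonempty _               _         _         (d , d∉D) 4F = (d , true) , cong not d∉D

  X₀≐singleton : X 0F ≐ singletonE G
  X₀≐singleton (a , s) with a ≟ e
  X₀≐singleton (a , false) | yes refl = refl
  X₀≐singleton (a , true)  | yes refl = refl
  X₀≐singleton (a , false) | no _     = refl
  X₀≐singleton (a , true)  | no _     = refl

  X-inv : ∀ i → invSet G (X i) ≐ X i
  X-inv i  (a , true)  = refl
  X-inv 0F (a , false) = ⌊inv≟e⌋ a
  X-inv 1F (a , false) = cong₂ (λ b c → b ∧ not c) (N-inv a) (⌊inv≟e⌋ a)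
  X-inv 2F (a , false) = cong not (N-inv a)
  X-inv 3F (a , false) = refl
  X-inv 4F (a , false) = refl

  module Layer₀ {H : Subset G.Carrier} {P : Subset Carrier} (H≡ : ∀ a s → H (a , s) ≡ not s ∧ P a) where

    ∉H : ∀ {a} → ¬ (a , true) ∈ˢ H
    ∉H {a} p with () ← trans (sym (H≡ a true)) p

    ∈P : ∀ {a} → (a , false) ∈ˢ H → a ∈ˢ P
    ∈P {a} p = trans (sym (H≡ a false)) p

    subgroup : IsSubgroup grp P → IsSubgroup G H
    subgroup (e∈P , ·-closed , inv-closed) = trans (H≡ e false) e∈P , ·-closedᴴ , inv-closedᴴ
      where
      ·-closedᴴ : ∀ x y → x ∈ˢ H → y ∈ˢ H → (x G.· y) ∈ˢ H
      ·-closedᴴ (a , false) (b , false) p q = trans (H≡ (a · b) false) (·-closed a b (∈P p) (∈P q))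
      ·-closedᴴ (a , false) (b , true)  p q = ⊥-elim (∉H q)
      ·-closedᴴ (a , true)  y           p q = ⊥-elim (∉H p)
      inv-closedᴴ : ∀ x → x ∈ˢ H → G.inv x ∈ˢ H
      inv-closedᴴ (a , false) p = trans (H≡ (inv a) false) (inv-closed a (∈P p))
      inv-closedᴴ (a , true)  p = ⊥-elim (∉H p)

    X₃-disjoint : ∀ x → x ∈ˢ X 3F → ¬ x ∈ˢ H
    X₃-disjoint (a , true) _ = ∉H

    X₄-disjoint : ∀ x → x ∈ˢ X 4F → ¬ x ∈ˢ H
    X₄-disjoint (a , true) _ = ∉H

  H₁ H₂ : Subset G.Carrier
  H₁ = singletonE G ∪ˢ X 1F
  H₂ = H₁ ∪ˢ X 2F

  H₁-layer : ∀ a s → H₁ (a , s) ≡ not s ∧ N a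
  H₁-layer a s = trans (cong (_∨ X 1F (a , s)) (sym (X₀≐singleton (a , s)))) (by-cases s)
    where
    by-cases : ∀ s → X 0F (a , s) ∨ X 1F (a , s) ≡ not s ∧ N a
    by-cases true = refl
    by-cases false with a ≟ e | N a in a∈N
    ... | yes refl | true  = refl
    ... | yes refl | false with () ← trans (sym N-e) a∈N
    ... | no _     | true  = refl
    ... | no _     | false = refl

  H₂-layer : ∀ a s → H₂ (a , s) ≡ not s ∧ true
  H₂-layer a s = trans (cong (_∨ X 2F (a , s)) (H₁-layer a s)) (by-cases s (N a))
    where
    by-cases : ∀ s b → (not s ∧ b) ∨ (not s ∧ not b) ≡ not s ∧ true
    by-cases true  b     = refl
    by-cases false true  = refl
    by-cases false false = refl

  ⊆-∪ˡ : ∀ {S T : Subset G.Carrier} → S ⊆ˢ (S ∪ˢ T)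
  ⊆-∪ˡ {T = T} x x∈S = cong (_∨ T x) x∈S

  ⊆-∪ʳ : ∀ {S T : Subset G.Carrier} → T ⊆ˢ (S ∪ˢ T)
  ⊆-∪ʳ {S} x x∈T = trans (cong (S x ∨_) x∈T) (∨-zeroʳ (S x))

  X₀⊆H₁ : X 0F ⊆ˢ H₁
  X₀⊆H₁ x x∈X₀ = ⊆-∪ˡ {singletonE G} {X 1F} x (trans (sym (X₀≐singleton x)) x∈X₀)

  X₀⊆H₂ : X 0F ⊆ˢ H₂
  X₀⊆H₂ x x∈X₀ = ⊆-∪ˡ {H₁} {X 2F} x (X₀⊆H₁ x x∈X₀)

  X₁⊆H₂ : X 1F ⊆ˢ H₂
  X₁⊆H₂ x x∈X₁ = ⊆-∪ˡ {H₁} {X 2F} x (⊆-∪ʳ {singletonE G} {X 1F} x x∈X₁)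

  X₂⊆H₂ : X 2F ⊆ˢ H₂
  X₂⊆H₂ = ⊆-∪ʳ {H₁} {X 2F}

  H₁-𝒜-subgroup : IsASubgroup G 5 X H₁
  H₁-𝒜-subgroup = subgroup N≤ , saturated
    where
    open Layer₀ H₁-layer
    saturated : ∀ i → (X i ⊆ˢ H₁) ⊎ (∀ x → x ∈ˢ X i → ¬ x ∈ˢ H₁)
    saturated 0F = inj₁ X₀⊆H₁
    saturated 1F = inj₁ ⊆-∪ʳ
    saturated 2F = inj₂ λ { (a , false) a∉N x∈H₁ → not-¬ refl (trans (∈P x∈H₁) (sym a∉N)) }
    saturated 3F = inj₂ X₃-disjoint
    saturated 4F = inj₂ X₄-disjoint

  H₂-𝒜-subgroup : IsASubgroup G 5 X H₂
  H₂-𝒜-subgroup = subgroup (refl , (λ _ _ _ _ → refl) , (λ _ _ → refl)) , saturated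
    where
    open Layer₀ H₂-layer
    saturated : ∀ i → (X i ⊆ˢ H₂) ⊎ (∀ x → x ∈ˢ X i → ¬ x ∈ˢ H₂)
    saturated 0F = inj₁ X₀⊆H₂
    saturated 1F = inj₁ X₁⊆H₂
    saturated 2F = inj₁ X₂⊆H₂
    saturated 3F = inj₂ X₃-disjoint
    saturated 4F = inj₂ X₄-disjoint

  e∈rad : ∀ Y → InRad G Y (e , false)
  e∈rad Y = (λ x p → subst (_∈ˢ Y) (sym (e·x≡x x)) p) , (λ y p → y , p , e·x≡x y)
          , (λ x p → subst (_∈ˢ Y) (sym (x·e≡x x)) p) , (λ y p → y , p , x·e≡x y)
    where
    e·x≡x : ∀ x → (e , false) G.· x ≡ x
    e·x≡x (a , s) = cong (_, s) (identityˡ a)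
    x·e≡x : ∀ x → x G.· (e , false) ≡ x
    x·e≡x (a , false) = cong (_, false) (identityʳ a)
    x·e≡x (a , true)  = cong (_, true) (trans (cong (a ·_) ε⁻¹≈ε) (identityʳ a))

  rad-on-layer₁ : ∀ {P : Subset Carrier} {Y : Subset G.Carrier} → (∀ a s → Y (a , s) ≡ s ∧ P a) →
    ∀ {p} → P p ≡ true → ∀ {c t} → InRad G Y (c , t) → t ≡ false × (∀ a → P (c · a) ≡ P a)
  rad-on-layer₁ Y≡ {p} p∈P {c} {true} (left , _)
    with () ← trans (sym (Y≡ (c · inv p) false)) (left (p , true) (trans (Y≡ p true) p∈P))
  rad-on-layer₁ {P} Y≡ p∈P {c} {false} (left , left-onto , _) = refl , λ a → ⇔→≡ (mk⇔ (bwd a) (fwd a))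
    where
    fwd : ∀ a → P a ≡ true → P (c · a) ≡ true
    fwd a a∈P = trans (sym (Y≡ (c · a) true)) (left (a , true) (trans (Y≡ a true) a∈P))
    bwd : ∀ a → P (c · a) ≡ true → P a ≡ true
    bwd a ca∈P with left-onto (c · a , true) (trans (Y≡ (c · a) true) ca∈P)
    ... | (a′ , true) , a′∈Y , c·a′≡c·a =
      subst (_∈ˢ P) (cancelˡ c a′ a (cong proj₁ c·a′≡c·a)) (trans (sym (Y≡ a′ true)) a′∈Y)

module DivisibleDifferenceSet (A : FinAbGroup) (N D : Subset (FinGroupData.Carrier (FinAbGroup.grp A)))
  (N≤ : IsSubgroup (FinAbGroup.grp A) N) {λ₁ λ₂ : ℕ}
  (reps-N : ∀ g → g ∈ˢ N → ¬ g ≡ FinGroupData.e (FinAbGroup.grp A) → reps (FinAbGroup.grp A) D g ≡ λ₁)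
  (reps-A∖N : ∀ g → N g ≡ false → reps (FinAbGroup.grp A) D g ≡ λ₂)
  (ic : IntersectionCondition (FinAbGroup.grp A) N D) where

  open FinAbGroup A using (grp; elems-complete)
  open FinGroupData grp
  open AbelianGroupRing A
  open Subgroup N≤
  open Semidirect A
  open BasicSets A N D N≤ using (X; N-e; e∈rad; rad-on-layer₁)
  open Int using (_+_; _*_; _-_)

  E : Fin 3 → ZG grp
  E 0F = δ e
  E 1F = under grp N
  E 2F = one

  O : Fin 2 → ZG grp
  O 0F = under grp D
  O 1F = one

  Ō : Fin 2 → ZG grp
  Ō t = O t ∘ inv

  E-piecewise : ∀ α β γ {f} → f ≗ (λ a → if ⌊ a ≟ e ⌋ then α else if N a then β else γ) → f ∈Span E
  E-piecewise α β γ f≗ = c , λ a → trans (f≗ a) (pointwise a)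
    where
    c : Fin 3 → ℤ
    c 0F = α - β
    c 1F = β - γ
    c 2F = γ
    at-e : ∀ α β γ → α ≡ (α - β) * + 1 + ((β - γ) * + 1 + (γ * + 1 + + 0))
    at-e = solve-∀
    on-N : ∀ α β γ → β ≡ (α - β) * + 0 + ((β - γ) * + 1 + (γ * + 1 + + 0))
    on-N = solve-∀
    off-N : ∀ α β γ → γ ≡ (α - β) * + 0 + ((β - γ) * + 0 + (γ * + 1 + + 0))
    off-N = solve-∀
    pointwise : ∀ a → (if ⌊ a ≟ e ⌋ then α else if N a then β else γ) ≡ lin c E a
    pointwise a with a ≟ e | N a in a∈N
    ... | yes refl | true  = at-e α β γ
    ... | yes refl | false with () ← trans (sym N-e) a∈N
    ... | no _     | true  = on-N α β γ
    ... | no _     | false = off-N α β γ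

  O-piecewise : ∀ α β {f} → f ≗ (λ a → if D a then α else β) → f ∈Span O
  O-piecewise α β f≗ = c , λ a → trans (f≗ a) (pointwise a)
    where
    c : Fin 2 → ℤ
    c 0F = α - β
    c 1F = β
    on-D : ∀ α β → α ≡ (α - β) * + 1 + (β * + 1 + + 0)
    on-D = solve-∀
    off-D : ∀ α β → β ≡ (α - β) * + 0 + (β * + 1 + + 0)
    off-D = solve-∀
    pointwise : ∀ a → (if D a then α else β) ≡ lin c O a
    pointwise a with D a
    ... | true  = on-D α β
    ... | false = off-D α β

  E-const : ∀ z → (λ _ → z) ∈Span E
  E-const = ∈Span-const {W = E} 2F (λ _ → refl)

  O-const : ∀ z → (λ _ → z) ∈Span O
  O-const = ∈Span-const {W = O} 1F (λ _ → refl)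

  E-inv : ∀ j → E j ∘ inv ≗ E j
  E-inv 0F a = cong ⟦_⟧ (⌊inv≟e⌋ a)
  E-inv 1F a = cong ⟦_⟧ (N-inv a)
  E-inv 2F a = refl

  E⋆E : ∀ i j → E i ∗ E j ∈Span E
  E⋆E 0F j  = ∈Span-resp (⋆-identityˡ (E j)) (basis j)
  E⋆E i  0F = ∈Span-resp (⋆-identityʳ (E i)) (basis i)
  E⋆E i  2F = ∈Span-resp (⋆-oneʳ (E i)) (E-const _)
  E⋆E 2F j  = ∈Span-resp (⋆-oneˡ (E j)) (E-const _)
  E⋆E 1F 1F = ∈Span-resp ⋆-subgroup (∈Span-* (∑ (under grp N)) (basis 1F))

  E⋆O : ∀ i j → E i ∗ O j ∈Span O
  E⋆O 0F j  = ∈Span-resp (⋆-identityˡ (O j)) (basis j)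
  E⋆O i  1F = ∈Span-resp (⋆-oneʳ (E i)) (O-const _)
  E⋆O 2F j  = ∈Span-resp (⋆-oneˡ (O j)) (O-const _)
  E⋆O 1F 0F = ∈Span-resp N⋆D (O-const _)
    where
    N⋆D : under grp N ∗ under grp D ≗ λ _ → + card grp (D ∩ˢ rcoset grp N e)
    N⋆D a = trans (⋆-comm (under grp N) (under grp D) a) (trans (⋆-rcoset D a) (cong +_ (ic a e)))

  O⋆E : ∀ i j → O i ∗ E j ∈Span O
  O⋆E i j = ∈Span-resp (⋆-comm (O i) (E j)) (E⋆O j i)

  O⋆Ē : ∀ i j → O i ∗ (E j ∘ inv) ∈Span O
  O⋆Ē i j = ∈Span-resp (⋆-cong {O i} {O i} (λ _ → refl) (E-inv j)) (O⋆E i j)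

  O⋆Ō : ∀ i j → O i ∗ Ō j ∈Span E
  O⋆Ō 0F 0F = E-piecewise (+ reps grp D e) (+ λ₁) (+ λ₂) (λ a → trans (⋆-reps D a) (D⋆D⁻¹ a))
    where
    D⋆D⁻¹ : ∀ a → + reps grp D a ≡ (if ⌊ a ≟ e ⌋ then + reps grp D e else if N a then + λ₁ else + λ₂)
    D⋆D⁻¹ a with a ≟ e | N a in a∈N
    ... | yes refl | _     = refl
    ... | no a≢e   | true  = cong +_ (reps-N a a∈N a≢e)
    ... | no _     | false = cong +_ (reps-A∖N a a∈N)
  O⋆Ō i  1F = ∈Span-resp (⋆-oneʳ (O i)) (E-const _)
  O⋆Ō 1F j  = ∈Span-resp (⋆-oneˡ (Ō j)) (E-const _)

  Graded : ZG G → Set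
  Graded f = layer false f ∈Span E × layer true f ∈Span O

  Graded-⋆ : ∀ {f h} → Graded f → Graded h → Graded (f ℤG.∗ h)
  Graded-⋆ {f} {h} (f₀ , f₁) (h₀ , h₁) =
      ∈Span-resp (⋆-layer f h false) (∈Span-+ (∈Span-⋆ E⋆E f₀ h₀) (∈Span-⋆ O⋆Ō f₁ (∈Span-∘ inv h₁)))
    , ∈Span-resp (⋆-layer f h true)  (∈Span-+ (∈Span-⋆ E⋆O f₀ h₁) (∈Span-⋆ O⋆Ē f₁ (∈Span-∘ inv h₀)))

  graded-X : ∀ i → Graded (under G (X i))
  graded-X 0F = basis 0F , O-const (+ 0)
  graded-X 1F = E-piecewise (+ 0) (+ 1) (+ 0) pointwise , O-const (+ 0)
    where
    pointwise : ∀ a → ⟦ N a ∧ not ⌊ a ≟ e ⌋ ⟧ ≡ (if ⌊ a ≟ e ⌋ then + 0 else if N a then + 1 else + 0)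
    pointwise a with a ≟ e | N a
    ... | yes _ | b     = cong ⟦_⟧ (∧-zeroʳ b)
    ... | no _  | true  = refl
    ... | no _  | false = refl
  graded-X 2F = E-piecewise (+ 0) (+ 0) (+ 1) pointwise , O-const (+ 0)
    where
    pointwise : ∀ a → ⟦ not (N a) ⟧ ≡ (if ⌊ a ≟ e ⌋ then + 0 else if N a then + 0 else + 1)
    pointwise a with a ≟ e | N a in a∈N
    ... | yes refl | true  = refl
    ... | yes refl | false with () ← trans (sym N-e) a∈N
    ... | no _     | true  = refl
    ... | no _     | false = refl
  graded-X 3F = E-const (+ 0) , basis 0F
  graded-X 4F = E-const (+ 0) , O-piecewise (+ 0) (+ 1) pointwise
    where
    pointwise : ∀ a → ⟦ not (D a) ⟧ ≡ (if D a then + 0 else + 1)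
    pointwise a with D a
    ... | true  = refl
    ... | false = refl

  Graded⇒∈Span : ∀ {f} → Graded f → f ℤG.∈Span (under G ∘ X)
  Graded⇒∈Span {f} (f₀ , f₁) = ℤG.∈Span-resp (embed-layers f)
    (ℤG.∈Span-+ (embed-∈Span false embed-E f₀) (embed-∈Span true embed-O f₁))
    where
    embed-E : ∀ t → embed false (E t) ℤG.∈Span (under G ∘ X)
    embed-E 0F = ℤG.∈Span-resp (λ { (a , false) → refl ; (a , true) → refl }) (ℤG.basis 0F)
    embed-E 1F = ℤG.∈Span-resp pointwise (ℤG.∈Span-+ (ℤG.basis 0F) (ℤG.basis 1F))
      where
      pointwise : ∀ x → embed false (under grp N) x ≡ ⟦ X 0F x ⟧ + ⟦ X 1F x ⟧
      pointwise (a , true)  = refl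
      pointwise (a , false) with a ≟ e | N a in a∈N
      ... | yes refl | true  = refl
      ... | yes refl | false with () ← trans (sym N-e) a∈N
      ... | no _     | true  = refl
      ... | no _     | false = refl
    embed-E 2F = ℤG.∈Span-resp pointwise (ℤG.∈Span-+ (ℤG.∈Span-+ (ℤG.basis 0F) (ℤG.basis 1F)) (ℤG.basis 2F))
      where
      pointwise : ∀ x → embed false one x ≡ ⟦ X 0F x ⟧ + ⟦ X 1F x ⟧ + ⟦ X 2F x ⟧
      pointwise (a , true)  = refl
      pointwise (a , false) with a ≟ e | N a in a∈N
      ... | yes refl | true  = refl
      ... | yes refl | false with () ← trans (sym N-e) a∈N
      ... | no _     | true  = refl
      ... | no _     | false = refl

    embed-O : ∀ t → embed true (O t) ℤG.∈Span (under G ∘ X)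
    embed-O 0F = ℤG.∈Span-resp (λ { (a , false) → refl ; (a , true) → refl }) (ℤG.basis 3F)
    embed-O 1F = ℤG.∈Span-resp pointwise (ℤG.∈Span-+ (ℤG.basis 3F) (ℤG.basis 4F))
      where
      pointwise : ∀ x → embed true one x ≡ ⟦ X 3F x ⟧ + ⟦ X 4F x ⟧
      pointwise (a , false) = refl
      pointwise (a , true) with D a
      ... | true  = refl
      ... | false = refl

  X-⋆-closed : ∀ i j → Σ (Fin 5 → ℤ) λ c →
    ∀ x → (under G (X i) ℤG.∗ under G (X j)) x ≡ sumFin 5 (λ t → c t * under G (X t) x)
  X-⋆-closed i j = c , λ x → trans (expansion x) (sym (sumFin≡sum 5 (λ t → c t * under G (X t) x)))
    where
    open ℤG._∈Span_ (Graded⇒∈Span {under G (X i) ℤG.∗ under G (X j)}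
                                  (Graded-⋆ {under G (X i)} {under G (X j)} (graded-X i) (graded-X j)))
      renaming (coefficients to c)

  module Radicals (N≢A : ∃[ w ] N w ≡ false) (D≢∅ : ∃[ d ] D d ≡ true) (D≢A : ∃[ d ] D d ≡ false) where

    d₀ d₁ w : Carrier
    d₀ = proj₁ D≢∅
    d₁ = proj₁ D≢A
    w  = proj₁ N≢A

    -- D would be a union of N-cosets, so D ∩ N d₀ ∋ d₀ while D ∩ N d₁ = ∅.
    λ₁≢|D| : ¬ λ₁ ≡ card grp D
    λ₁≢|D| λ₁≡|D| = not-¬ d₀∈D∩Nd₀
      (countL-≡0 elems (trans (ic d₀ d₁) (countL-none elems D∩Nd₁-empty)) (elems-complete d₀))
      where
      N-stable : ∀ h → h ∈ˢ N → RightStable D h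
      N-stable h h∈N with h ≟ e
      ... | yes refl = λ x x∈D → subst (_∈ˢ D) (sym (identityʳ x)) x∈D
      ... | no h≢e   = subst (RightStable D) (⁻¹-involutive h) (reps≡card⇒stable D (inv h)
                         (trans (reps-N (inv h) (trans (N-inv h) h∈N) (h≢e ∘ inv≡e⇒≡e h)) λ₁≡|D|))
      D∩Nd₁-empty : ∀ x → (D ∩ˢ rcoset grp N d₁) x ≡ false
      D∩Nd₁-empty x with D x in x∈D | N (x · inv d₁) in x∈Nd₁
      ... | false | _     = refl
      ... | true  | false = refl
      ... | true  | true  = ⊥-elim (not-¬ d₁∈D (proj₂ D≢A))
        where
        d₁∈D : d₁ ∈ˢ D
        d₁∈D = subst (_∈ˢ D) (x∙[x∙y⁻¹]⁻¹≈y x d₁)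
                 (N-stable (inv (x · inv d₁)) (trans (N-inv _) x∈Nd₁) x x∈D)
      d₀∈D∩Nd₀ : (D ∩ˢ rcoset grp N d₀) d₀ ≡ true
      d₀∈D∩Nd₀ = cong₂ _∧_ (proj₂ D≢∅) (trans (cong N (inverseʳ d₀)) N-e)

    -- D would be stable under A ∖ N, which generates A since h = (h · w) · w⁻¹ with h · w, w⁻¹ ∉ N.
    λ₂≢|D| : ¬ λ₂ ≡ card grp D
    λ₂≢|D| λ₂≡|D| = not-¬ d₁∈D (proj₂ D≢A)
      where
      A∖N-stable : ∀ h → N h ≡ false → RightStable D h
      A∖N-stable h h∉N = subst (RightStable D) (⁻¹-involutive h)
        (reps≡card⇒stable D (inv h) (trans (reps-A∖N (inv h) (trans (N-inv h) h∉N)) λ₂≡|D|))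
      stable : ∀ h → RightStable D h
      stable h with N h in h∈N
      ... | false = A∖N-stable h h∈N
      ... | true  = subst (RightStable D) (//-rightDividesʳ w h)
        (stable-· (A∖N-stable (h · w) hw∉N) (A∖N-stable (inv w) (trans (N-inv w) (proj₂ N≢A))))
        where
        hw∉N : N (h · w) ≡ false
        hw∉N = trans (sym (N-\\ h∈N (h · w))) (trans (cong N (\\-leftDividesʳ h w)) (proj₂ N≢A))
      d₁∈D : d₁ ∈ˢ D
      d₁∈D = subst (_∈ˢ D) (\\-leftDividesˡ d₀ d₁) (stable (inv d₀ · d₁) d₀ (proj₂ D≢∅))

    invariant⇒e : ∀ c → (∀ a → D (c · a) ≡ D a) → c ≡ e
    invariant⇒e c invariant with c ≟ e | N c in c∈N
    ... | yes c≡e | _     = c≡e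
    ... | no c≢e  | true  =
      ⊥-elim (λ₁≢|D| (trans (sym (reps-N c c∈N c≢e)) (invariant⇒reps≡card D c invariant)))
    ... | no _    | false =
      ⊥-elim (λ₂≢|D| (trans (sym (reps-A∖N c c∈N)) (invariant⇒reps≡card D c invariant)))

    X₃-rad : RadTrivial G (X 3F)
    X₃-rad (c , t) =
        (λ g∈rad → let t≡false , invariant = rad-on-layer₁ (λ _ _ → refl) (proj₂ D≢∅) g∈rad
                   in cong₂ _,_ (invariant⇒e c invariant) t≡false)
      , λ { refl → e∈rad (X 3F) }

    X₄-rad : RadTrivial G (X 4F)
    X₄-rad (c , t) =
        (λ g∈rad → let t≡false , invariant = rad-on-layer₁ (λ _ _ → refl) (cong not (proj₂ D≢A)) g∈rad
                   in cong₂ _,_ (invariant⇒e c (λ a → not-injective (invariant a))) t≡false)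
      , λ { refl → e∈rad (X 4F) }

open import Data.Nat using (_*_; _∸_)

lemma6p1 : (A : FinAbGroup) → (N D : Subset (FinGroupData.Carrier (FinAbGroup.grp A)))
    → IsSubgroup (FinAbGroup.grp A) N
    → (∃[ x ] N x ≡ false)
    → (∃[ x ] N x ≡ true × ¬ x ≡ FinGroupData.e (FinAbGroup.grp A))
    → (m n k λ₁ λ₂ : ℕ)
    → IsDDS (FinAbGroup.grp A) N D m n k λ₁ λ₂
    → 1 < m → 1 < n
    → IntersectionCondition (FinAbGroup.grp A) N D
    → k ≤ m * n ∸ k
    → IsHigmanian (semidirect A) (Xs A N D)
lemma6p1 A N D N≤ N≢A N≢1 m n k λ₁ λ₂ (_ , _ , |A|≡mn , |D|≡k , D≢∅ , reps-N , reps-A∖N) 1<m 1<n ic k≤mn∸k =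
    ( X-nonempty N≢1 N≢A D≢∅ D≢A , X-disjoint , X-cover , (0F , X₀≐singleton)
    , (λ i → i , λ x → sym (X-inv i x)) , X-⋆-closed )
  , X-inv , 1F , 2F , H₁-𝒜-subgroup , H₂-𝒜-subgroup , radical
  where
  open AbelianGroupRing A using (card≢|A|⇒∃∉)
  open BasicSets A N D N≤
  open DivisibleDifferenceSet A N D N≤ reps-N reps-A∖N ic using (X-⋆-closed; module Radicals)

  D≢A : ∃[ d ] D d ≡ false
  D≢A = card≢|A|⇒∃∉ D λ |D|≡|A| → k≢mn (trans (sym |D|≡k) (trans |D|≡|A| |A|≡mn))
    where
    k≢mn : ¬ k ≡ m * n
    k≢mn refl = [ ℕP.m<n⇒n≢0 1<m , ℕP.m<n⇒n≢0 1<n ]′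
      (ℕP.m*n≡0⇒m≡0∨n≡0 m (ℕP.n≤0⇒n≡0 (subst (m * n ≤_) (ℕP.n∸n≡0 (m * n)) k≤mn∸k)))

  open Radicals N≢A D≢∅ D≢A using (X₃-rad; X₄-rad)

  radical : ∀ j → ¬ (X j ⊆ˢ H₂) → RadTrivial G (X j)
  radical 0F X₀⊈H₂ = ⊥-elim (X₀⊈H₂ X₀⊆H₂)
  radical 1F X₁⊈H₂ = ⊥-elim (X₁⊈H₂ X₁⊆H₂)
  radical 2F X₂⊈H₂ = ⊥-elim (X₂⊈H₂ X₂⊆H₂)
  radical 3F _     = X₃-rad
  radical 4F _     = X₄-rad
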